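{- For a positive integer $m$ divisible by $32$, let $L$ and $R$ be disjoint sets of size $m/2$, and for each $i\in L$ choose independently a subset $S_i\subseteq R$ uniformly at random among all subsets of size $m/4$. Let $p_m$ be the probability that there exists a set $M\subseteq L$ of size $\frac m4$ that has a segmentation. Then $p_m\to0$ as $m\to\infty$.
   Context: A segmentation of $i\in L$ is a partition $\{R_1,\dots,R_{m/4}\}$ of $R$ into sets of size $2$ such that at most one quarter of the sets $R_j$ satisfy $|S_i\cap R_j|=1$. A partition is a segmentation of $M\subseteq L$ if it is a segmentation of every $i\in M$. -}

module Defs where

open import Data.Nat using (ℕ; _*_; _≤_; _/_)
open import Data.Nat.Properties using (_≟_)
open import Data.Fin using (Fin)
open import Data.Fin.Subset using (Subset; _∈_; _∩_; ∣_∣; inside; outside)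
open import Data.Fin.Properties using () renaming (_≟_ to _≟ᶠ_)
open import Data.Vec using (Vec; lookup; tabulate)
open import Data.Bool using (Bool; if_then_else_)
open import Data.Product using (Σ; _×_; ∃-syntax)
open import Relation.Nullary using (does)
open import Relation.Binary.PropositionalEquality using (_≡_)

-- Setting: L = R = Fin h with h = m/2 (two disjoint copies), q = m/4.
-- An outcome of the random experiment: the family (S_i)_{i ∈ L}, S_i ⊆ R.
Config : ℕ → Set
Config h = Vec (Subset h) h

-- every S_i has size q (the support of the uniform distribution)
Valid : (h q : ℕ) → Config h → Set
Valid h q S = ∀ (i : Fin h) → ∣ lookup S i ∣ ≡ q

-- A labelled partition {R_1,…,R_q} of R is given by the block map blk : R → Fin q,
-- R_j = blk⁻¹(j).
block : ∀ {h q} → (Fin h → Fin q) → Fin q → Subset h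
block blk j = tabulate (λ r → does (blk r ≟ᶠ j))

PartitionInto2 : ∀ {h q} → (Fin h → Fin q) → Set
PartitionInto2 {h} {q} blk = ∀ (j : Fin q) → ∣ block blk j ∣ ≡ 2

crossing : ∀ {h q} → Subset h → (Fin h → Fin q) → ℕ
crossing {h} {q} S blk = ∣ tabulate {n = q} (λ j → does (∣ S ∩ block blk j ∣ ≟ 1)) ∣

IsSegmentationOf : ∀ {h q} → (Fin h → Fin q) → Subset h → Set
IsSegmentationOf {h} {q} blk Si = PartitionInto2 blk × (4 * crossing Si blk ≤ q)

HasSegmentedSet : (h q : ℕ) → Config h → Set
HasSegmentedSet h q S =
  ∃[ M ] (∣ M ∣ ≡ q × ∃[ blk ] (∀ (i : Fin h) → i ∈ M → IsSegmentationOf {h} {q} blk (lookup S i)))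

-- A configuration with a segmented set M and partition blk is determined by M, blk, the sets S_i for
-- i ∉ M, and, for each i ∈ M, the set T of blocks crossed by S_i (|T| ≤ q/4) together with the values
-- of S_i on the least element of every block: inside a block the two values agree unless the block is
-- in T. So at most 2^h · q^h · (N · 2^q)^q · (2^h)^q configurations have a segmented set, where
-- N ≤ 3^{q/4} (4/3)^q < 2^{0.82 q} counts the sets T. Against the (h C q)^h ≥ (2^h / (h+1))^h valid
-- configurations this is a proportion of at most 2^{O(m log m)} · 2^{-0.18 q²}, below 1/k for large m.
module Submission where

open import Defs
open import Data.Nat using (ℕ; zero; suc; _+_; _*_; _∸_; _≤_; _<_; _/_; _^_; z≤n; s≤s; NonZero)
open import Data.Nat.Properties
open import Data.Nat.Divisibility using (_∣_; divides)
open import Data.Nat.DivMod using (m*n/n≡m)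
open import Data.Nat.Combinatorics using (_C_; nCk+nC[k+1]≡[n+1]C[k+1]; nCk≡nC[n∸k]; nC1≡n; k>n⇒nCk≡0)
open import Data.Nat.Solver using (module +-*-Solver)
open import Data.Fin using (Fin; zero; suc)
import Data.Fin as Fin
import Data.Fin.Properties as Finₚ
open import Data.Fin.Subset
  using (Subset; _∩_; ∣_∣; ∁; Empty; inside; outside) renaming (_∈_ to _∈ₛ_; _∉_ to _∉ₛ_)
open import Data.Fin.Subset.Properties
  using (x∈p⇒∣p-x∣<∣p∣; x∈p∧x≢y⇒x∈p-y; p⊂q⇒∣p∣<∣q∣; p∩q⊆q; x∈p∩q⁺; x∈p∩q⁻; Empty-unique; ∣⊥∣≡0; _∈?_; ∣∁p∣≡n∸∣p∣)
open import Data.Vec using (Vec; []; _∷_; lookup; tabulate; replicate) renaming (map to mapᵥ)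
open import Data.Vec.Properties
  using (lookup⇒[]=; []=⇒lookup; lookup∘tabulate; tabulate-cong; tabulate∘lookup; lookup-replicate; lookup-map)
open import Data.Bool using (true; false; _xor_; _∧_; if_then_else_)
open import Data.List using (List; []; _∷_; [_]; _++_; map; length; concatMap; cartesianProductWith; filter; allFin)
open import Data.List.Properties using (length-++; length-map; length-filter; length-tabulate)
open import Data.List.Membership.Propositional using (_∈_; lose)
open import Data.List.Membership.Propositional.Properties
  using (∈-++⁺ˡ; ∈-++⁺ʳ; ∈-map⁺; ∈-cartesianProductWith⁺; ∈-concatMap⁺; ∈-filter⁺; ∈-filter⁻; ∈-allFin)
open import Data.List.Relation.Unary.Any using (here; there)
open import Data.Product using (∃; ∃-syntax; _×_; _,_; proj₁; proj₂)
open import Data.Sum using (_⊎_; inj₁; inj₂)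
open import Function using (_∘_)
open import Relation.Nullary using (Dec; yes; no; does; ¬_; contradiction)
open import Relation.Nullary.Decidable using (dec-true; dec-false; _×-dec_; ¬?)
open import Relation.Binary using (tri<; tri≈; tri>)
open import Relation.Binary.PropositionalEquality
  using (_≡_; _≢_; _≗_; refl; sym; trans; cong; cong₂; subst; subst₂; module ≡-Reasoning)
open import Algebra.Properties.CommutativeSemigroup *-commutativeSemigroup using (x∙yz≈y∙xz)
open +-*-Solver

private variable
  A B Z : Set
  n : ℕ

lookup≡false⇒∉ : ∀ {x} {p : Subset n} → lookup p x ≡ false → x ∉ₛ p
lookup≡false⇒∉ eq x∈p with trans (sym eq) ([]=⇒lookup x∈p)
... | ()

x∈p⇒0<∣p∣ : ∀ {x} {p : Subset n} → x ∈ₛ p → 0 < ∣ p ∣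
x∈p⇒0<∣p∣ x∈p = ≤-trans (s≤s z≤n) (x∈p⇒∣p-x∣<∣p∣ x∈p)

x,y∈p⇒1<∣p∣ : ∀ {x y} {p : Subset n} → x ∈ₛ p → y ∈ₛ p → x ≢ y → 1 < ∣ p ∣
x,y∈p⇒1<∣p∣ x∈p y∈p x≢y =
  ≤-trans (s≤s (x∈p⇒0<∣p∣ (x∈p∧x≢y⇒x∈p-y y∈p (x≢y ∘ sym)))) (x∈p⇒∣p-x∣<∣p∣ x∈p)

x,y,z∈p⇒2<∣p∣ : ∀ {x y z} {p : Subset n} → x ∈ₛ p → y ∈ₛ p → z ∈ₛ p →
                x ≢ y → x ≢ z → y ≢ z → 2 < ∣ p ∣
x,y,z∈p⇒2<∣p∣ x∈p y∈p z∈p x≢y x≢z y≢z =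
  ≤-trans (s≤s (x,y∈p⇒1<∣p∣ (x∈p∧x≢y⇒x∈p-y y∈p (x≢y ∘ sym)) (x∈p∧x≢y⇒x∈p-y z∈p (x≢z ∘ sym)) y≢z))
          (x∈p⇒∣p-x∣<∣p∣ x∈p)

Empty⇒∣p∣≡0 : ∀ {p : Subset n} → Empty p → ∣ p ∣ ≡ 0
Empty⇒∣p∣≡0 {n} empty = trans (cong ∣_∣ (Empty-unique empty)) (∣⊥∣≡0 n)

module _ {p : Subset n} (∣p∣≡2 : ∣ p ∣ ≡ 2) where

  ∣S∩p∣≡1 : ∀ {S : Subset n} {x y} → x ∈ₛ p → y ∈ₛ p → x ∈ₛ S → y ∉ₛ S → ∣ S ∩ p ∣ ≡ 1
  ∣S∩p∣≡1 {S} x∈p y∈p x∈S y∉S = ≤-antisym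
    (≤-pred (subst (∣ S ∩ p ∣ <_) ∣p∣≡2 (p⊂q⇒∣p∣<∣q∣ (p∩q⊆q S p , _ , y∈p , y∉S ∘ proj₁ ∘ x∈p∩q⁻ S p))))
    (x∈p⇒0<∣p∣ (x∈p∩q⁺ (x∈S , x∈p)))

  module _ {x y} (x∈p : x ∈ₛ p) (y∈p : y ∈ₛ p) (x≢y : x ≢ y) where

    ∣p∣≡2⇒only-x,y : ∀ {z} → z ∈ₛ p → z ≡ x ⊎ z ≡ y
    ∣p∣≡2⇒only-x,y {z} z∈p with z Finₚ.≟ x | z Finₚ.≟ y
    ... | yes z≡x | _ = inj₁ z≡x
    ... | no _ | yes z≡y = inj₂ z≡y
    ... | no z≢x | no z≢y =
      contradiction (subst (2 <_) ∣p∣≡2 (x,y,z∈p⇒2<∣p∣ x∈p y∈p z∈p x≢y (z≢x ∘ sym) (z≢y ∘ sym))) (<-irrefl refl)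

    does[∣S∩p∣≡1]≡xor : ∀ (S : Subset n) → does (∣ S ∩ p ∣ ≟ 1) ≡ lookup S x xor lookup S y
    does[∣S∩p∣≡1]≡xor S with lookup S x in Sx | lookup S y in Sy
    ... | true | true = dec-false (_ ≟ 1) λ ∣S∩p∣≡1 → <-irrefl refl (subst (1 <_) ∣S∩p∣≡1
          (x,y∈p⇒1<∣p∣ (x∈p∩q⁺ (lookup⇒[]= x S Sx , x∈p)) (x∈p∩q⁺ (lookup⇒[]= y S Sy , y∈p)) x≢y))
    ... | true | false = dec-true (_ ≟ 1) (∣S∩p∣≡1 x∈p y∈p (lookup⇒[]= x S Sx) (lookup≡false⇒∉ Sy))
    ... | false | true = dec-true (_ ≟ 1) (∣S∩p∣≡1 y∈p x∈p (lookup⇒[]= y S Sy) (lookup≡false⇒∉ Sx))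
    ... | false | false = dec-false (_ ≟ 1) λ ∣S∩p∣≡1 → 0≢1+n (trans (sym (Empty⇒∣p∣≡0 S∩p-empty)) ∣S∩p∣≡1)
      where
      S∩p-empty : Empty (S ∩ p)
      S∩p-empty (z , z∈S∩p) with x∈p∩q⁻ S p z∈S∩p
      ... | z∈S , z∈p with ∣p∣≡2⇒only-x,y z∈p
      ...   | inj₁ refl = lookup≡false⇒∉ Sx z∈S
      ...   | inj₂ refl = lookup≡false⇒∉ Sy z∈S

-- Subsets of a set partitioned into pairs

module Pairing {h q : ℕ} (blk : Fin h → Fin q) where

  HasEarlier : Fin h → Set
  HasEarlier r = ∃ λ y → y Fin.< r × blk y ≡ blk r

  hasEarlier? : ∀ r → Dec (HasEarlier r)
  hasEarlier? r = Finₚ.any? λ y → (y Finₚ.<? r) ×-dec (blk y Finₚ.≟ blk r)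

  leader-unique : ∀ {x y} → ¬ HasEarlier x → ¬ HasEarlier y → blk x ≡ blk y → x ≡ y
  leader-unique {x} {y} ¬ex ¬ey bx≡by with Finₚ.<-cmp x y
  ... | tri< x<y _ _ = contradiction (x , x<y , bx≡by) ¬ey
  ... | tri≈ _ x≡y _ = x≡y
  ... | tri> _ _ y<x = contradiction (y , y<x , sym bx≡by) ¬ex

  ∈-block : ∀ {r j} → blk r ≡ j → r ∈ₛ block blk j
  ∈-block {r} {j} br≡j = lookup⇒[]= r (block blk j)
    (trans (lookup∘tabulate (λ r → does (blk r Finₚ.≟ j)) r) (dec-true (blk r Finₚ.≟ j) br≡j))

  crossingSet : Subset h → Subset q
  crossingSet S = tabulate λ j → does (∣ S ∩ block blk j ∣ ≟ 1)

  IsLeaderIn : Subset h → Fin q → Fin h → Set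
  IsLeaderIn S j r = blk r ≡ j × ¬ HasEarlier r × r ∈ₛ S

  leaderIn? : ∀ S j → Dec (∃ (IsLeaderIn S j))
  leaderIn? S j = Finₚ.any? λ r → (blk r Finₚ.≟ j) ×-dec ¬? (hasEarlier? r) ×-dec (r ∈? S)

  leaderValues : Subset h → Subset q
  leaderValues S = tabulate λ j → does (leaderIn? S j)

  leaderValues-leader : ∀ S {r} → ¬ HasEarlier r → lookup (leaderValues S) (blk r) ≡ lookup S r
  leaderValues-leader S {r} ¬er = trans (lookup∘tabulate _ (blk r)) (leader-in-S (lookup S r) refl)
    where
    leader-in-S : ∀ b → lookup S r ≡ b → does (leaderIn? S (blk r)) ≡ b
    leader-in-S true Sr = dec-true (leaderIn? S (blk r)) (r , refl , ¬er , lookup⇒[]= r S Sr)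
    leader-in-S false Sr = dec-false (leaderIn? S (blk r)) λ (r′ , br′≡br , ¬er′ , r′∈S) →
      lookup≡false⇒∉ Sr (subst (_∈ₛ S) (leader-unique ¬er′ ¬er br′≡br) r′∈S)

  -- The later element of a block takes the leader's value, flipped when the block is crossing.
  decode : Subset q → Subset q → Subset h
  decode T b = tabulate λ r → (does (hasEarlier? r) ∧ lookup T (blk r)) xor lookup b (blk r)

  module _ (part : PartitionInto2 blk) where

    earlier⇒leader : ∀ {y r} → y Fin.< r → blk y ≡ blk r → ¬ HasEarlier y
    earlier⇒leader {y} {r} y<r by≡br (z , z<y , bz≡by) = <-irrefl refl (subst (2 <_) (part (blk r))
      (x,y,z∈p⇒2<∣p∣ (∈-block (trans bz≡by by≡br)) (∈-block by≡br) (∈-block refl)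
        (Finₚ.<⇒≢ z<y) (Finₚ.<⇒≢ (Finₚ.<-trans z<y y<r)) (Finₚ.<⇒≢ y<r)))

    decode-encode : ∀ S → decode (crossingSet S) (leaderValues S) ≡ S
    decode-encode S = trans (tabulate-cong decodes) (tabulate∘lookup S)
      where
      xor-cancel : ∀ a b → (a xor b) xor a ≡ b
      xor-cancel true true = refl
      xor-cancel true false = refl
      xor-cancel false true = refl
      xor-cancel false false = refl

      decodes : ∀ r → (does (hasEarlier? r) ∧ lookup (crossingSet S) (blk r)) xor lookup (leaderValues S) (blk r)
                      ≡ lookup S r
      decodes r with hasEarlier? r
      ... | no ¬er = leaderValues-leader S ¬er
      ... | yes (y , y<r , by≡br) = begin
        lookup (crossingSet S) (blk r) xor lookup (leaderValues S) (blk r)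
          ≡⟨ cong₂ _xor_ (lookup∘tabulate _ (blk r)) (cong (lookup (leaderValues S)) (sym by≡br)) ⟩
        does (∣ S ∩ block blk (blk r) ∣ ≟ 1) xor lookup (leaderValues S) (blk y)
          ≡⟨ cong₂ _xor_ (does[∣S∩p∣≡1]≡xor (part (blk r)) (∈-block by≡br) (∈-block refl) (Finₚ.<⇒≢ y<r) S)
                         (leaderValues-leader S (earlier⇒leader y<r by≡br)) ⟩
        (lookup S y xor lookup S r) xor lookup S y
          ≡⟨ xor-cancel (lookup S y) (lookup S r) ⟩
        lookup S r ∎
        where open ≡-Reasoning

length-cartesianProductWith : ∀ (f : A → B → Z) xs ys →
  length (cartesianProductWith f xs ys) ≡ length xs * length ys
length-cartesianProductWith f [] ys = refl
length-cartesianProductWith f (x ∷ xs) ys = trans (length-++ (map (f x) ys))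
  (cong₂ _+_ (length-map (f x) ys) (length-cartesianProductWith f xs ys))

length-concatMap-≤ : ∀ (f : A → List B) {K} xs → (∀ {x} → x ∈ xs → length (f x) ≤ K) →
  length (concatMap f xs) ≤ length xs * K
length-concatMap-≤ f [] bound = z≤n
length-concatMap-≤ f (x ∷ xs) bound = ≤-trans (≤-reflexive (length-++ (f x)))
  (+-mono-≤ (bound (here refl)) (length-concatMap-≤ f xs (bound ∘ there)))

choices : Vec (List A) n → List (Vec A n)
choices [] = [ [] ]
choices (xs ∷ xss) = cartesianProductWith _∷_ xs (choices xss)

∈-choices : ∀ (xss : Vec (List A) n) {v} → (∀ i → lookup v i ∈ lookup xss i) → v ∈ choices xss
∈-choices [] {[]} entries = here refl
∈-choices (xs ∷ xss) {x ∷ v} entries =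
  ∈-cartesianProductWith⁺ _∷_ (entries zero) (∈-choices xss (entries ∘ suc))

∈-concatMap⁺′ : ∀ (f : A → List B) {xs x y} → x ∈ xs → y ∈ f x → y ∈ concatMap f xs
∈-concatMap⁺′ f x∈xs y∈fx = ∈-concatMap⁺ f (lose x∈xs y∈fx)

vectors : ∀ n → List A → List (Vec A n)
vectors n xs = choices (replicate n xs)

∈-vectors : ∀ {xs : List A} {v : Vec A n} → (∀ i → lookup v i ∈ xs) → v ∈ vectors n xs
∈-vectors {n = n} {xs} entries = ∈-choices (replicate n xs) λ i → subst (_ ∈_) (sym (lookup-replicate i xs)) (entries i)

length-vectors : ∀ n (xs : List A) → length (vectors n xs) ≡ length xs ^ n
length-vectors zero xs = refl
length-vectors (suc n) xs =
  trans (length-cartesianProductWith _∷_ xs _) (cong (length xs *_) (length-vectors n xs))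

mask : List A → List A → Subset n → Vec (List A) n
mask ins outs = mapᵥ (λ b → if b then ins else outs)

length-choices-mask : ∀ (ins outs : List A) (M : Subset n) →
  length (choices (mask ins outs M)) ≡ length ins ^ ∣ M ∣ * length outs ^ ∣ ∁ M ∣
length-choices-mask ins outs [] = refl
length-choices-mask ins outs (true ∷ M) = trans (length-cartesianProductWith _∷_ ins _)
  (trans (cong (length ins *_) (length-choices-mask ins outs M)) (sym (*-assoc (length ins) _ _)))
length-choices-mask ins outs (false ∷ M) = trans (length-cartesianProductWith _∷_ outs _)
  (trans (cong (length outs *_) (length-choices-mask ins outs M)) (x∙yz≈y∙xz (length outs) (length ins ^ ∣ M ∣) (length outs ^ ∣ ∁ M ∣)))

subsets : ∀ n → List (Subset n)
subsets n = vectors n (outside ∷ inside ∷ [])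

∈-subsets : ∀ (p : Subset n) → p ∈ subsets n
∈-subsets p = ∈-vectors λ i → ∈-bools (lookup p i)
  where
  ∈-bools : ∀ b → b ∈ outside ∷ inside ∷ []
  ∈-bools false = here refl
  ∈-bools true = there (here refl)

length-subsets : ∀ n → length (subsets n) ≡ 2 ^ n
length-subsets n = length-vectors n _

subsetsOfSize≤ : ∀ n → ℕ → List (Subset n)
subsetsOfSize≤ zero s = [ [] ]
subsetsOfSize≤ (suc n) zero = map (outside ∷_) (subsetsOfSize≤ n zero)
subsetsOfSize≤ (suc n) (suc s) = map (outside ∷_) (subsetsOfSize≤ n (suc s)) ++ map (inside ∷_) (subsetsOfSize≤ n s)

∈-subsetsOfSize≤ : ∀ {n s} (p : Subset n) → ∣ p ∣ ≤ s → p ∈ subsetsOfSize≤ n s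
∈-subsetsOfSize≤ [] _ = here refl
∈-subsetsOfSize≤ {s = zero} (outside ∷ p) ∣p∣≤s = ∈-map⁺ (outside ∷_) (∈-subsetsOfSize≤ p ∣p∣≤s)
∈-subsetsOfSize≤ {s = suc s} (outside ∷ p) ∣p∣≤s = ∈-++⁺ˡ (∈-map⁺ (outside ∷_) (∈-subsetsOfSize≤ p ∣p∣≤s))
∈-subsetsOfSize≤ {s = suc s} (inside ∷ p) (s≤s ∣p∣≤s) = ∈-++⁺ʳ _ (∈-map⁺ (inside ∷_) (∈-subsetsOfSize≤ p ∣p∣≤s))

-- Σ_{i ≤ s} (n choose i) ≤ Σ_i (n choose i) 3^(s-i) = 3^s (4/3)^n.
length-subsetsOfSize≤ : ∀ n s → length (subsetsOfSize≤ n s) * 3 ^ n ≤ 3 ^ s * 4 ^ n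
length-subsetsOfSize≤ zero s = begin
  1         ≤⟨ m^n>0 3 s ⟩
  3 ^ s     ≡⟨ sym (*-identityʳ _) ⟩
  3 ^ s * 1 ∎
  where open ≤-Reasoning
length-subsetsOfSize≤ (suc n) zero = begin
  length (map (outside ∷_) (subsetsOfSize≤ n zero)) * (3 * 3 ^ n) ≡⟨ cong (_* (3 * 3 ^ n)) (length-map _ (subsetsOfSize≤ n zero)) ⟩
  a * (3 * 3 ^ n)   ≡⟨ x∙yz≈y∙xz a 3 (3 ^ n) ⟩
  3 * (a * 3 ^ n)   ≤⟨ *-monoʳ-≤ 3 (length-subsetsOfSize≤ n zero) ⟩
  3 * (1 * 4 ^ n)   ≤⟨ *-monoˡ-≤ (1 * 4 ^ n) (n≤1+n 3) ⟩
  4 * (1 * 4 ^ n)   ≡⟨ x∙yz≈y∙xz 4 1 (4 ^ n) ⟩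
  1 * (4 * 4 ^ n)   ∎
  where
  open ≤-Reasoning
  a = length (subsetsOfSize≤ n zero)
length-subsetsOfSize≤ (suc n) (suc s) = begin
  length (map (outside ∷_) (subsetsOfSize≤ n (suc s)) ++ map (inside ∷_) (subsetsOfSize≤ n s)) * (3 * 3 ^ n)
    ≡⟨ cong (_* (3 * 3 ^ n)) (trans (length-++ (map (outside ∷_) (subsetsOfSize≤ n (suc s))))
         (cong₂ _+_ (length-map _ (subsetsOfSize≤ n (suc s))) (length-map _ (subsetsOfSize≤ n s)))) ⟩
  (a + b) * (3 * 3 ^ n)
    ≡⟨ solve 3 (λ a b x → (a :+ b) :* (con 3 :* x) := con 3 :* (a :* x) :+ con 3 :* (b :* x)) refl a b (3 ^ n) ⟩
  3 * (a * 3 ^ n) + 3 * (b * 3 ^ n)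
    ≤⟨ +-mono-≤ (*-monoʳ-≤ 3 (length-subsetsOfSize≤ n (suc s))) (*-monoʳ-≤ 3 (length-subsetsOfSize≤ n s)) ⟩
  3 * (3 * 3 ^ s * 4 ^ n) + 3 * (3 ^ s * 4 ^ n)
    ≡⟨ solve 2 (λ x y → con 3 :* (con 3 :* x :* y) :+ con 3 :* (x :* y) := con 3 :* x :* (con 4 :* y)) refl (3 ^ s) (4 ^ n) ⟩
  3 * 3 ^ s * (4 * 4 ^ n) ∎
  where
  open ≤-Reasoning
  a = length (subsetsOfSize≤ n (suc s))
  b = length (subsetsOfSize≤ n s)

-- Binomial coefficients and powers

[k+1]*[n+1]C[k+1]≡[n+1]*nCk : ∀ n k → suc k * (suc n C suc k) ≡ suc n * (n C k)
[k+1]*[n+1]C[k+1]≡[n+1]*nCk zero zero = refl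
[k+1]*[n+1]C[k+1]≡[n+1]*nCk zero (suc k) =
  trans (cong (suc (suc k) *_) (k>n⇒nCk≡0 {1} {suc (suc k)} (s≤s (s≤s z≤n))))
        (trans (*-zeroʳ (suc (suc k))) (sym (k>n⇒nCk≡0 {0} {suc k} (s≤s z≤n))))
[k+1]*[n+1]C[k+1]≡[n+1]*nCk (suc n) zero = trans (*-identityˡ _) (trans (nC1≡n (suc (suc n))) (sym (*-identityʳ _)))
[k+1]*[n+1]C[k+1]≡[n+1]*nCk (suc n) (suc k) = begin
  (2 + k) * ((2 + n) C (2 + k))
    ≡⟨ cong ((2 + k) *_) (sym (nCk+nC[k+1]≡[n+1]C[k+1] (suc n) (suc k))) ⟩
  (2 + k) * (a + b)
    ≡⟨ cong ((2 + k) *_) (cong (_+ b) (sym (nCk+nC[k+1]≡[n+1]C[k+1] n k))) ⟩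
  (2 + k) * ((c + d) + b)
    ≡⟨ solve 4 (λ k c d b → (con 2 :+ k) :* ((c :+ d) :+ b) := (con 1 :+ k) :* (c :+ d) :+ (c :+ d) :+ (con 2 :+ k) :* b) refl k c d b ⟩
  (1 + k) * (c + d) + (c + d) + (2 + k) * b
    ≡⟨ cong₂ (λ x y → x + (c + d) + y) (trans (cong (suc k *_) (nCk+nC[k+1]≡[n+1]C[k+1] n k)) ([k+1]*[n+1]C[k+1]≡[n+1]*nCk n k))
                                      ([k+1]*[n+1]C[k+1]≡[n+1]*nCk n (suc k)) ⟩
  (1 + n) * c + (c + d) + (1 + n) * d
    ≡⟨ solve 3 (λ n c d → (con 1 :+ n) :* c :+ (c :+ d) :+ (con 1 :+ n) :* d := (con 2 :+ n) :* (c :+ d)) refl n c d ⟩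
  (2 + n) * (c + d)
    ≡⟨ cong ((2 + n) *_) (nCk+nC[k+1]≡[n+1]C[k+1] n k) ⟩
  (2 + n) * a ∎
  where
  open ≡-Reasoning
  a = suc n C suc k
  b = suc n C suc (suc k)
  c = n C k
  d = n C suc k

[n+1]*[2n+2]C[n+1]≡2*[2n+1]*[2n]Cn : ∀ n → suc n * ((suc n + suc n) C suc n) ≡ 2 * (suc (n + n) * ((n + n) C n))
[n+1]*[2n+2]C[n+1]≡2*[2n+1]*[2n]Cn n = begin
  suc n * ((suc n + suc n) C suc n)             ≡⟨ cong (λ m → suc n * (suc m C suc n)) (+-suc n n) ⟩
  suc n * (suc (suc (n + n)) C suc n)           ≡⟨ cong (suc n *_) (sym (nCk+nC[k+1]≡[n+1]C[k+1] (suc (n + n)) n)) ⟩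
  suc n * (suc (n + n) C n + X)                 ≡⟨ cong (λ Y → suc n * (Y + X)) middle-symmetric ⟩
  suc n * (X + X)                               ≡⟨ solve 2 (λ m X → m :* (X :+ X) := con 2 :* (m :* X)) refl (suc n) X ⟩
  2 * (suc n * X)                               ≡⟨ cong (2 *_) ([k+1]*[n+1]C[k+1]≡[n+1]*nCk (n + n) n) ⟩
  2 * (suc (n + n) * ((n + n) C n))             ∎
  where
  open ≡-Reasoning
  X = suc (n + n) C suc n
  middle-symmetric : suc (n + n) C n ≡ X
  middle-symmetric = trans (nCk≡nC[n∸k] (m≤n⇒m≤1+n (m≤m+n n n))) (cong (suc (n + n) C_) (m+n∸n≡m (suc n) n))

4^n≤[2n+1]*[2n]Cn : ∀ n → 4 ^ n ≤ suc (n + n) * ((n + n) C n)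
4^n≤[2n+1]*[2n]Cn zero = s≤s z≤n
4^n≤[2n+1]*[2n]Cn (suc n) = *-cancelˡ-≤ (suc n) (begin
  suc n * (4 * 4 ^ n)
    ≡⟨ solve 2 (λ n X → (con 1 :+ n) :* (con 4 :* X) := (con 4 :+ con 4 :* n) :* X) refl n (4 ^ n) ⟩
  (4 + 4 * n) * 4 ^ n
    ≤⟨ *-monoˡ-≤ (4 ^ n) (+-monoˡ-≤ (4 * n) (m≤m+n 4 2)) ⟩
  (6 + 4 * n) * 4 ^ n
    ≤⟨ *-monoʳ-≤ (6 + 4 * n) (4^n≤[2n+1]*[2n]Cn n) ⟩
  (6 + 4 * n) * (suc (n + n) * c)
    ≡⟨ solve 2 (λ n Z → (con 6 :+ con 4 :* n) :* Z := (con 1 :+ ((con 1 :+ n) :+ (con 1 :+ n))) :* (con 2 :* Z))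
               refl n (suc (n + n) * c) ⟩
  suc (suc n + suc n) * (2 * (suc (n + n) * c))
    ≡⟨ cong (suc (suc n + suc n) *_) (sym ([n+1]*[2n+2]C[n+1]≡2*[2n+1]*[2n]Cn n)) ⟩
  suc (suc n + suc n) * (suc n * c′)
    ≡⟨ x∙yz≈y∙xz (suc (suc n + suc n)) (suc n) c′ ⟩
  suc n * (suc (suc n + suc n) * c′) ∎)
  where
  open ≤-Reasoning
  c = (n + n) C n
  c′ = (suc n + suc n) C suc n

^-distribʳ-* : ∀ a b n → (a * b) ^ n ≡ a ^ n * b ^ n
^-distribʳ-* a b zero = refl
^-distribʳ-* a b (suc n) = trans (cong (a * b *_) (^-distribʳ-* a b n)) ([m*n]*[o*p]≡[m*o]*[n*p] a b (a ^ n) (b ^ n))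

2^[n+n]≡4^n : ∀ n → 2 ^ (n + n) ≡ 4 ^ n
2^[n+n]≡4^n n = trans (^-distribˡ-+-* 2 n n) (sym (^-distribʳ-* 2 2 n))

n<2^n : ∀ n → n < 2 ^ n
n<2^n zero = s≤s z≤n
n<2^n (suc n) = +-mono-≤ (m^n>0 2 n) (subst (n <_) (sym (+-identityʳ (2 ^ n))) (n<2^n n))

[1+n]^4≤2*n^4 : ∀ n → 16 ≤ n → suc n ^ 4 ≤ 2 * n ^ 4
[1+n]^4≤2*n^4 n 16≤n = *-cancelˡ-≤ (16 ^ 4) (begin
  16 ^ 4 * suc n ^ 4     ≡⟨ sym (^-distribʳ-* 16 (suc n) 4) ⟩
  (16 * suc n) ^ 4       ≤⟨ ^-monoˡ-≤ 4 16[1+n]≤17n ⟩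
  (17 * n) ^ 4           ≡⟨ ^-distribʳ-* 17 n 4 ⟩
  17 ^ 4 * n ^ 4         ≤⟨ *-monoˡ-≤ (n ^ 4) (≤ᵇ⇒≤ (17 ^ 4) (16 ^ 4 * 2) _) ⟩
  16 ^ 4 * 2 * n ^ 4     ≡⟨ *-assoc (16 ^ 4) 2 (n ^ 4) ⟩
  16 ^ 4 * (2 * n ^ 4)   ∎)
  where
  open ≤-Reasoning
  16[1+n]≤17n : 16 * suc n ≤ 17 * n
  16[1+n]≤17n = begin
    16 * suc n    ≡⟨ *-suc 16 n ⟩
    16 + 16 * n   ≤⟨ +-monoˡ-≤ (16 * n) 16≤n ⟩
    n + 16 * n    ∎

n^4≤2^n : ∀ n → 16 ≤ n → n ^ 4 ≤ 2 ^ n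
n^4≤2^n n 16≤n = subst (λ m → m ^ 4 ≤ 2 ^ m) (m+[n∸m]≡n 16≤n) (from16 (n ∸ 16))
  where
  from16 : ∀ y → (16 + y) ^ 4 ≤ 2 ^ (16 + y)
  from16 zero = ≤-refl
  from16 (suc y) = begin
    (16 + suc y) ^ 4   ≡⟨ cong (_^ 4) (+-suc 16 y) ⟩
    suc (16 + y) ^ 4   ≤⟨ [1+n]^4≤2*n^4 (16 + y) (m≤m+n 16 y) ⟩
    2 * (16 + y) ^ 4   ≤⟨ *-monoʳ-≤ 2 (from16 y) ⟩
    2 * 2 ^ (16 + y)   ≡⟨ cong (2 ^_) (sym (+-suc 16 y)) ⟩
    2 ^ (16 + suc y)   ∎
    where open ≤-Reasoning


-- Covering the configurations that have a segmented set

block-cong : ∀ {h q} {blk blk′ : Fin h → Fin q} → blk ≗ blk′ → ∀ j → block blk j ≡ block blk′ j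
block-cong blk≗blk′ j = tabulate-cong λ r → cong (λ i → does (i Finₚ.≟ j)) (blk≗blk′ r)

IsSegmentationOf-cong : ∀ {h q} {blk blk′ : Fin h → Fin q} {S} →
  blk ≗ blk′ → IsSegmentationOf blk S → IsSegmentationOf blk′ S
IsSegmentationOf-cong {S = S} blk≗blk′ (part , few) =
  (λ j → trans (cong ∣_∣ (sym (block-cong blk≗blk′ j))) (part j)) ,
  subst (λ c → 4 * c ≤ _) (cong ∣_∣ (tabulate-cong λ j → cong (λ B → does (∣ S ∩ B ∣ ≟ 1)) (block-cong blk≗blk′ j))) few

module Covering (h q s : ℕ) (quarter≤s : ∀ {c} → 4 * c ≤ q → c ≤ s) where

  open Pairing

  segmentedBy : (Fin h → Fin q) → List (Subset h)
  segmentedBy blk = cartesianProductWith (decode blk) (subsetsOfSize≤ q s) (subsets q)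

  ∈-segmentedBy : ∀ blk {S} → IsSegmentationOf blk S → S ∈ segmentedBy blk
  ∈-segmentedBy blk {S} (part , few) = subst (_∈ segmentedBy blk) (decode-encode blk part S)
    (∈-cartesianProductWith⁺ (decode blk) (∈-subsetsOfSize≤ (crossingSet blk S) (quarter≤s few))
                                          (∈-subsets (leaderValues blk S)))

  length-segmentedBy : ∀ blk → length (segmentedBy blk) ≡ length (subsetsOfSize≤ q s) * 2 ^ q
  length-segmentedBy blk = trans (length-cartesianProductWith (decode blk) (subsetsOfSize≤ q s) (subsets q))
                                 (cong (length (subsetsOfSize≤ q s) *_) (length-subsets q))

  hasSize-q? : ∀ (M : Subset h) → Dec (∣ M ∣ ≡ q)
  hasSize-q? M = ∣ M ∣ ≟ q

  blockMaps : List (Vec (Fin q) h)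
  blockMaps = vectors h (allFin q)

  configsWith : Subset h → Vec (Fin q) h → List (Config h)
  configsWith M blk = choices (mask (segmentedBy (lookup blk)) (subsets h) M)

  configsWithSegmentedSet : List (Config h)
  configsWithSegmentedSet = concatMap (λ M → concatMap (configsWith M) blockMaps) (filter hasSize-q? (subsets h))

  ∈-configsWithSegmentedSet : ∀ {S} → HasSegmentedSet h q S → S ∈ configsWithSegmentedSet
  ∈-configsWithSegmentedSet {S} (M , ∣M∣≡q , blk , segmented) =
    ∈-concatMap⁺′ (λ M → concatMap (configsWith M) blockMaps) (∈-filter⁺ hasSize-q? (∈-subsets M) ∣M∣≡q)
      (∈-concatMap⁺′ (configsWith M) {x = tabulate blk} (∈-vectors (∈-allFin ∘ blk′))
        (∈-choices (mask (segmentedBy blk′) (subsets h) M) λ i →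
          subst (lookup S i ∈_) (sym (lookup-map i _ M)) (entry i (lookup M i) refl)))
    where
    blk′ = lookup (tabulate blk)

    entry : ∀ i b → lookup M i ≡ b → lookup S i ∈ (if b then segmentedBy blk′ else subsets h)
    entry i true i∈M = ∈-segmentedBy blk′
      (IsSegmentationOf-cong {blk = blk} {blk′} {lookup S i} (sym ∘ lookup∘tabulate blk) (segmented i (lookup⇒[]= i M i∈M)))
    entry i false _ = ∈-subsets (lookup S i)

  length-configsWithSegmentedSet : length configsWithSegmentedSet ≤
    2 ^ h * q ^ h * ((length (subsetsOfSize≤ q s) * 2 ^ q) ^ q * (2 ^ h) ^ (h ∸ q))
  length-configsWithSegmentedSet = begin
    length configsWithSegmentedSet
      ≤⟨ length-concatMap-≤ (λ M → concatMap (configsWith M) blockMaps) (filter hasSize-q? (subsets h)) length-per-M ⟩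
    length (filter hasSize-q? (subsets h)) * (q ^ h * K) ≤⟨ *-monoˡ-≤ (q ^ h * K) (length-filter hasSize-q? (subsets h)) ⟩
    length (subsets h) * (q ^ h * K)                    ≡⟨ cong (_* (q ^ h * K)) (length-subsets h) ⟩
    2 ^ h * (q ^ h * K)                                 ≡⟨ sym (*-assoc (2 ^ h) (q ^ h) K) ⟩
    2 ^ h * q ^ h * K                                   ∎
    where
    open ≤-Reasoning
    K = (length (subsetsOfSize≤ q s) * 2 ^ q) ^ q * (2 ^ h) ^ (h ∸ q)

    length-configsWith : ∀ {M} → ∣ M ∣ ≡ q → ∀ blk → length (configsWith M blk) ≡ K
    length-configsWith {M} ∣M∣≡q blk = trans (length-choices-mask (segmentedBy (lookup blk)) (subsets h) M)
      (cong₂ _*_ (cong₂ _^_ (length-segmentedBy (lookup blk)) ∣M∣≡q)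
                 (cong₂ _^_ (length-subsets h) (trans (∣∁p∣≡n∸∣p∣ M) (cong (h ∸_) ∣M∣≡q))))

    length-per-M : ∀ {M} → M ∈ filter hasSize-q? (subsets h) → length (concatMap (configsWith M) blockMaps) ≤ q ^ h * K
    length-per-M {M} M∈ = begin
      length (concatMap (configsWith M) blockMaps)
        ≤⟨ length-concatMap-≤ (configsWith M) blockMaps (λ {blk} _ → ≤-reflexive (length-configsWith {M} ∣M∣≡q blk)) ⟩
      length blockMaps * K
        ≡⟨ cong (_* K) (trans (length-vectors h (allFin q)) (cong (_^ h) (length-tabulate {n = q} (λ i → i)))) ⟩
      q ^ h * K ∎
      where ∣M∣≡q = proj₂ (∈-filter⁻ hasSize-q? {xs = subsets h} M∈)

-- The estimate

module Estimate (u k : ℕ) (37+k≤u : 37 + k ≤ u) where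

  open ≤-Reasoning

  q h s U : ℕ
  q = 8 * u
  h = q + q
  s = 2 * u
  U = u * u

  37≤u : 37 ≤ u
  37≤u = ≤-trans (m≤m+n 37 k) 37+k≤u

  2q[1+h]≤2^9*U : 2 * q * suc h ≤ 2 ^ 9 * U
  2q[1+h]≤2^9*U = begin
    2 * q * suc h
      ≡⟨ solve 1 (λ u → con 2 :* (con 8 :* u) :* (con 1 :+ (con 8 :* u :+ con 8 :* u)) := con 16 :* u :* (con 1 :+ con 16 :* u))
                 refl u ⟩
    16 * u * (1 + 16 * u) ≤⟨ *-monoʳ-≤ (16 * u) (+-monoˡ-≤ (16 * u) (≤-trans (s≤s z≤n) 37≤u)) ⟩
    16 * u * (17 * u)     ≡⟨ solve 1 (λ u → con 16 :* u :* (con 17 :* u) := con 272 :* (u :* u)) refl u ⟩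
    272 * U               ≤⟨ *-monoˡ-≤ U (≤ᵇ⇒≤ 272 (2 ^ 9) _) ⟩
    2 ^ 9 * U             ∎

  U^h≤[2^u]^q : U ^ h ≤ (2 ^ u) ^ q
  U^h≤[2^u]^q = begin
    U ^ h          ≡⟨ ^-distribʳ-* u u h ⟩
    u ^ h * u ^ h  ≡⟨ sym (^-distribˡ-+-* u h h) ⟩
    u ^ (h + h)    ≡⟨ cong (u ^_) (solve 1 (λ u → (con 8 :* u :+ con 8 :* u) :+ (con 8 :* u :+ con 8 :* u) := con 4 :* (con 8 :* u)) refl u) ⟩
    u ^ (4 * q)    ≡⟨ sym (^-*-assoc u 4 q) ⟩
    (u ^ 4) ^ q    ≤⟨ ^-monoˡ-≤ q (n^4≤2^n u (≤-trans (≤ᵇ⇒≤ 16 37 _) 37≤u)) ⟩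
    (2 ^ u) ^ q    ∎

  k<2^u : k < 2 ^ u
  k<2^u = <-≤-trans (n<2^n k) (^-monoʳ-≤ 2 (≤-trans (m≤n+m k 37) 37+k≤u))

  2^h*q^h*[1+h]^h*k<2^12U : 2 ^ h * q ^ h * suc h ^ h * k < 2 ^ (12 * U)
  2^h*q^h*[1+h]^h*k<2^12U = begin-strict
    2 ^ h * q ^ h * suc h ^ h * k
      ≡⟨ cong (_* k) (trans (cong (_* suc h ^ h) (sym (^-distribʳ-* 2 q h))) (sym (^-distribʳ-* (2 * q) (suc h) h))) ⟩
    (2 * q * suc h) ^ h * k            ≤⟨ *-monoˡ-≤ k (^-monoˡ-≤ h 2q[1+h]≤2^9*U) ⟩
    (2 ^ 9 * U) ^ h * k                ≡⟨ cong (_* k) (^-distribʳ-* (2 ^ 9) U h) ⟩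
    (2 ^ 9) ^ h * U ^ h * k            ≤⟨ *-monoˡ-≤ k (*-monoʳ-≤ ((2 ^ 9) ^ h) U^h≤[2^u]^q) ⟩
    (2 ^ 9) ^ h * (2 ^ u) ^ q * k      <⟨ *-monoʳ-< ((2 ^ 9) ^ h * (2 ^ u) ^ q) {{nonZero}} k<2^u ⟩
    (2 ^ 9) ^ h * (2 ^ u) ^ q * 2 ^ u  ≡⟨ cong₂ (λ x y → x * y * 2 ^ u) (^-*-assoc 2 9 h) (^-*-assoc 2 u q) ⟩
    2 ^ (9 * h) * 2 ^ (u * q) * 2 ^ u
      ≡⟨ sym (trans (^-distribˡ-+-* 2 (9 * h + u * q) u) (cong (_* 2 ^ u) (^-distribˡ-+-* 2 (9 * h) (u * q)))) ⟩
    2 ^ (9 * h + u * q + u)            ≤⟨ ^-monoʳ-≤ 2 exponent-bound ⟩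
    2 ^ (12 * U)                       ∎
    where
    nonZero : NonZero ((2 ^ 9) ^ h * (2 ^ u) ^ q)
    nonZero = m*n≢0 _ _ {{m^n≢0 (2 ^ 9) h {{m^n≢0 2 9}}}} {{m^n≢0 (2 ^ u) q {{m^n≢0 2 u}}}}

    exponent-bound : 9 * h + u * q + u ≤ 12 * U
    exponent-bound = begin
      9 * h + u * q + u
        ≡⟨ solve 1 (λ u → con 9 :* (con 8 :* u :+ con 8 :* u) :+ u :* (con 8 :* u) :+ u := con 145 :* u :+ con 8 :* (u :* u)) refl u ⟩
      145 * u + 8 * U
        ≤⟨ +-monoˡ-≤ (8 * U) (*-monoˡ-≤ u (≤-trans (≤ᵇ⇒≤ 145 (4 * 37) _) (*-monoʳ-≤ 4 37≤u))) ⟩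
      4 * u * u + 8 * U
        ≡⟨ solve 1 (λ u → con 4 :* u :* u :+ con 8 :* (u :* u) := con 12 :* (u :* u)) refl u ⟩
      12 * U ∎

  2^[12U]*[2^q]^q≤[3^6u]^q : 2 ^ (12 * U) * (2 ^ q) ^ q ≤ (3 ^ (6 * u)) ^ q
  2^[12U]*[2^q]^q≤[3^6u]^q = begin
    2 ^ (12 * U) * (2 ^ q) ^ q   ≡⟨ cong (2 ^ (12 * U) *_) (^-*-assoc 2 q q) ⟩
    2 ^ (12 * U) * 2 ^ (q * q)   ≡⟨ sym (^-distribˡ-+-* 2 (12 * U) (q * q)) ⟩
    2 ^ (12 * U + q * q)
      ≡⟨ cong (2 ^_) (solve 1 (λ u → con 12 :* (u :* u) :+ con 8 :* u :* (con 8 :* u) := con 19 :* (con 4 :* (u :* u))) refl u) ⟩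
    2 ^ (19 * (4 * U))           ≡⟨ sym (^-*-assoc 2 19 (4 * U)) ⟩
    (2 ^ 19) ^ (4 * U)           ≤⟨ ^-monoˡ-≤ (4 * U) (≤ᵇ⇒≤ (2 ^ 19) (3 ^ 12) _) ⟩
    (3 ^ 12) ^ (4 * U)           ≡⟨ ^-*-assoc 3 12 (4 * U) ⟩
    3 ^ (12 * (4 * U))
      ≡⟨ cong (3 ^_) (solve 1 (λ u → con 12 :* (con 4 :* (u :* u)) := con 6 :* u :* (con 8 :* u)) refl u) ⟩
    3 ^ (6 * u * q)              ≡⟨ sym (^-*-assoc 3 (6 * u) q) ⟩
    (3 ^ (6 * u)) ^ q            ∎

  -- Multiplying by D = (h+1)^h · 3^{q²} turns the binomial bound into (4^q)^h ≤ ((h+1) · (h C q))^h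
  -- and the bound on A into a factor 3^{-q²}.
  covered-fraction<1/k : ∀ {A L} → A * 3 ^ q ≤ 3 ^ s * 4 ^ q →
    L ≤ 2 ^ h * q ^ h * ((A * 2 ^ q) ^ q * (2 ^ h) ^ (h ∸ q)) → L * k < (h C q) ^ h
  covered-fraction<1/k {A} {L} A-bound L-bound = *-cancelʳ-< D (L * k) (hCq ^ h) (begin-strict
    L * k * D
      ≤⟨ *-monoˡ-≤ D (*-monoˡ-≤ k L-bound) ⟩
    2 ^ h * q ^ h * ((A * 2 ^ q) ^ q * (2 ^ h) ^ (h ∸ q)) * k * D
      ≡⟨ regroup ⟩
    P * (A * 3 ^ q) ^ q * (2 ^ q) ^ q * (4 ^ q) ^ q
      ≤⟨ *-monoˡ-≤ ((4 ^ q) ^ q) (*-monoˡ-≤ ((2 ^ q) ^ q) (*-monoʳ-≤ P (^-monoˡ-≤ q A-bound))) ⟩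
    P * (3 ^ s * 4 ^ q) ^ q * (2 ^ q) ^ q * (4 ^ q) ^ q
      ≡⟨ regroup′ ⟩
    P * (2 ^ q) ^ q * ((3 ^ s) ^ q * (4 ^ q) ^ h)
      <⟨ *-monoˡ-< ((3 ^ s) ^ q * (4 ^ q) ^ h) {{nonZero}} (<-≤-trans
           (*-monoˡ-< ((2 ^ q) ^ q) {{m^n≢0 (2 ^ q) q {{m^n≢0 2 q}}}} 2^h*q^h*[1+h]^h*k<2^12U) 2^[12U]*[2^q]^q≤[3^6u]^q) ⟩
    (3 ^ (6 * u)) ^ q * ((3 ^ s) ^ q * (4 ^ q) ^ h)
      ≡⟨ collect-3s ⟩
    (3 ^ q) ^ q * (4 ^ q) ^ h
      ≤⟨ *-monoʳ-≤ ((3 ^ q) ^ q) (^-monoˡ-≤ h (4^n≤[2n+1]*[2n]Cn q)) ⟩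
    (3 ^ q) ^ q * (suc h * hCq) ^ h
      ≡⟨ cong ((3 ^ q) ^ q *_) (^-distribʳ-* (suc h) hCq h) ⟩
    (3 ^ q) ^ q * (suc h ^ h * hCq ^ h)
      ≡⟨ solve 3 (λ x y z → x :* (y :* z) := z :* (y :* x)) refl ((3 ^ q) ^ q) (suc h ^ h) (hCq ^ h) ⟩
    hCq ^ h * D ∎)
    where
    hCq D P : ℕ
    hCq = h C q
    D = suc h ^ h * (3 ^ q) ^ q
    P = 2 ^ h * q ^ h * suc h ^ h * k

    nonZero : NonZero ((3 ^ s) ^ q * (4 ^ q) ^ h)
    nonZero = m*n≢0 _ _ {{m^n≢0 (3 ^ s) q {{m^n≢0 3 s}}}} {{m^n≢0 (4 ^ q) h {{m^n≢0 4 q}}}}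

    regroup : 2 ^ h * q ^ h * ((A * 2 ^ q) ^ q * (2 ^ h) ^ (h ∸ q)) * k * D ≡ P * (A * 3 ^ q) ^ q * (2 ^ q) ^ q * (4 ^ q) ^ q
    regroup = trans
      (cong₂ (λ x y → 2 ^ h * q ^ h * (x * y) * k * D) (^-distribʳ-* A (2 ^ q) q) (cong₂ _^_ (2^[n+n]≡4^n q) (m+n∸n≡m q q)))
      (trans (solve 8 (λ a b α τ φ k c κ → a :* b :* (α :* τ :* φ) :* k :* (c :* κ) := a :* b :* c :* k :* (α :* κ) :* τ :* φ)
               refl (2 ^ h) (q ^ h) (A ^ q) ((2 ^ q) ^ q) ((4 ^ q) ^ q) k (suc h ^ h) ((3 ^ q) ^ q))
             (cong (λ x → P * x * (2 ^ q) ^ q * (4 ^ q) ^ q) (sym (^-distribʳ-* A (3 ^ q) q))))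

    regroup′ : P * (3 ^ s * 4 ^ q) ^ q * (2 ^ q) ^ q * (4 ^ q) ^ q ≡ P * (2 ^ q) ^ q * ((3 ^ s) ^ q * (4 ^ q) ^ h)
    regroup′ = trans (cong (λ x → P * x * (2 ^ q) ^ q * (4 ^ q) ^ q) (^-distribʳ-* (3 ^ s) (4 ^ q) q))
      (trans (solve 4 (λ p σ τ φ → p :* (σ :* φ) :* τ :* φ := p :* τ :* (σ :* (φ :* φ))) refl P ((3 ^ s) ^ q) ((2 ^ q) ^ q) ((4 ^ q) ^ q))
             (cong (λ x → P * (2 ^ q) ^ q * ((3 ^ s) ^ q * x)) (sym (^-distribˡ-+-* (4 ^ q) q q))))

    collect-3s : (3 ^ (6 * u)) ^ q * ((3 ^ s) ^ q * (4 ^ q) ^ h) ≡ (3 ^ q) ^ q * (4 ^ q) ^ h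
    collect-3s = trans (sym (*-assoc ((3 ^ (6 * u)) ^ q) ((3 ^ s) ^ q) ((4 ^ q) ^ h)))
      (cong (_* (4 ^ q) ^ h) (trans (sym (^-distribʳ-* (3 ^ (6 * u)) (3 ^ s) q))
        (cong (_^ q) (trans (sym (^-distribˡ-+-* 3 (6 * u) s))
          (cong (3 ^_) (solve 1 (λ u → con 6 :* u :+ con 2 :* u := con 8 :* u) refl u))))))

lemma4 : ∀ (k : ℕ) → 1 ≤ k → ∃[ N ] (∀ (m : ℕ) → N ≤ m → 0 < m → 32 ∣ m →
           ∃[ bad ] ((∀ (S : Config (m / 2)) → Valid (m / 2) (m / 4) S → HasSegmentedSet (m / 2) (m / 4) S → S ∈ bad)
                     × (length bad * k < ((m / 2) C (m / 4)) ^ (m / 2))))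
lemma4 k _ = 32 * (37 + k) , covering
  where
  Covers : ℕ → ℕ → Set
  Covers h q = ∃[ bad ] ((∀ (S : Config h) → Valid h q S → HasSegmentedSet h q S → S ∈ bad)
                         × (length bad * k < (h C q) ^ h))

  covering : ∀ m → 32 * (37 + k) ≤ m → 0 < m → 32 ∣ m → Covers (m / 2) (m / 4)
  covering .(u * 32) N≤m _ (divides u refl) = subst₂ Covers (sym m/2≡h) (sym m/4≡q)
    (configsWithSegmentedSet , (λ _ _ → ∈-configsWithSegmentedSet) ,
     covered-fraction<1/k {A = length (subsetsOfSize≤ q s)} (length-subsetsOfSize≤ q s) length-configsWithSegmentedSet)
    where
    open Estimate u k (*-cancelʳ-≤ (37 + k) u 32 (subst (_≤ u * 32) (*-comm 32 (37 + k)) N≤m))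
    open Covering h q s (λ {c} 4c≤q → *-cancelˡ-≤ 4 (subst (4 * c ≤_) (*-assoc 4 2 u) 4c≤q))

    m/2≡h : u * 32 / 2 ≡ h
    m/2≡h = trans (cong (_/ 2) (solve 1 (λ u → u :* con 32 := (con 8 :* u :+ con 8 :* u) :* con 2) refl u)) (m*n/n≡m h 2)

    m/4≡q : u * 32 / 4 ≡ q
    m/4≡q = trans (cong (_/ 4) (solve 1 (λ u → u :* con 32 := con 8 :* u :* con 4) refl u)) (m*n/n≡m q 4)
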